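{- For all integers $a\geq 0$ and $b\geq 0$: $$n(a,b,3)=\begin{cases}\infty & \text{if } a<2,\\ 6 & \text{if } a=2 \text{ and } b\in\{1,2\},\\ a+b+1 & \text{if } a=2 \text{ and } b\notin\{1,2\},\\ a+b+1 & \text{if } a\geq 3 \text{ and } ab \text{ is even},\\ a+b+2 & \text{if } a\geq 3 \text{ and } ab \text{ is odd}.\end{cases}$$
   Context: A weighted graph (wgraph) is a pair $G=(L,H)$ of simple finite graphs with $V(L)=V(H)$ and $E(L)\cap E(H)=\varnothing$; edges of $L$ are light (weight 1) and edges of $H$ are heavy (weight 2). A wcycle is a cycle (of length at least 3) in the graph with edge set $E(L)\cup E(H)$; its weight is the sum of the weights of its edges. The girth of $G$ is the minimum weight of a wcycle. $G$ is $(a,b)$-regular if $L$ is $a$-regular and $H$ is $b$-regular. An $(a,b,g)$-wgraph is an $(a,b)$-regular wgraph of girth $g$. $n(a,b,g)$ denotes the minimum order of an $(a,b,g)$-wgraph, and $n(a,b,g)=\infty$ if none exists. -}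

module Defs where

open import Data.Nat using (ℕ; zero; suc; _+_; _≤_; _<_)
open import Data.Bool using (Bool; true; false; if_then_else_; _∨_)
open import Data.Fin using (Fin)
open import Data.List using (List; []; _∷_; length; map; allFin)
open import Data.Nat.ListAction using (sum)
open import Data.List.Relation.Unary.All using (All)
open import Data.List.Relation.Unary.Unique.Propositional using (Unique)
open import Data.Product using (Σ; _×_; _,_)
open import Relation.Binary.PropositionalEquality using (_≡_)
open import Relation.Nullary using (¬_)

-- A weighted graph on vertex set Fin n: light graph L, heavy graph H,
-- both simple (symmetric, loopless), edge-disjoint.
record WGraph (n : ℕ) : Set where
  field
    L : Fin n → Fin n → Bool
    H : Fin n → Fin n → Bool
    L-sym   : ∀ u v → L u v ≡ L v u
    H-sym   : ∀ u v → H u v ≡ H v u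
    L-irr   : ∀ v → L v v ≡ false
    H-irr   : ∀ v → H v v ≡ false
    disjoint : ∀ u v → L u v ≡ true → H u v ≡ false

module _ {n : ℕ} (G : WGraph n) where
  open WGraph G

  indicator : Bool → ℕ
  indicator true  = 1
  indicator false = 0

  degL : Fin n → ℕ
  degL v = sum (map (λ u → indicator (L v u)) (allFin n))

  degH : Fin n → ℕ
  degH v = sum (map (λ u → indicator (H v u)) (allFin n))

  Regular : ℕ → ℕ → Set
  Regular a b = ∀ v → (degL v ≡ a) × (degH v ≡ b)

  Adj : Fin n → Fin n → Set
  Adj u v = (L u v ∨ H u v) ≡ true

  w : Fin n → Fin n → ℕ
  w u v = if L u v then 1 else (if H u v then 2 else 0)

cycEdges : {A : Set} → List A → List (A × A)
cycEdges {A} [] = []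
cycEdges {A} (x ∷ xs) = go (x ∷ xs)
  where
  go : List A → List (A × A)
  go [] = []
  go (y ∷ []) = (y , x) ∷ []
  go (y ∷ z ∷ zs) = (y , z) ∷ go (z ∷ zs)

module _ {n : ℕ} (G : WGraph n) where

  record WCycle : Set where
    field
      verts    : List (Fin n)
      long     : 3 ≤ length verts
      distinct : Unique verts
      adjacent : All (λ e → Adj G (Data.Product.proj₁ e) (Data.Product.proj₂ e)) (cycEdges verts)

  weight : WCycle → ℕ
  weight c = sum (map (λ e → w G (Data.Product.proj₁ e) (Data.Product.proj₂ e)) (cycEdges (WCycle.verts c)))

  -- girth = minimum weight of a wcycle (so a wcycle must exist)
  HasGirth : ℕ → Set
  HasGirth g = Σ WCycle (λ c → weight c ≡ g) × (∀ c → g ≤ weight c)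

Realizable : ℕ → ℕ → ℕ → ℕ → Set
Realizable a b g k = Σ (WGraph k) (λ G → Regular G a b × HasGirth G g)

MinOrderIs : ℕ → ℕ → ℕ → ℕ → Set
MinOrderIs a b g m = Realizable a b g m × (∀ k → k < m → ¬ Realizable a b g k)

MinOrderInfinite : ℕ → ℕ → ℕ → Set
MinOrderInfinite a b g = ∀ k → ¬ Realizable a b g k

-- A wcycle of weight 3 is a triangle of light edges, so girth 3 means that L has a triangle.
-- This forces a ≥ 2, and a vertex of the triangle together with its a + b neighbours gives
-- order ≥ a + b + 1. When a = 2 the triangle is a component of L, so for b ≥ 1 a fourth vertex
-- has two more L-neighbours and the order is at least 6. When a and b are odd, a + b + 1 is odd
-- and the handshake lemma rules it out.
--
-- The bounds are attained by graphs on {0, …, N − 1} whose heavy graph is the complement of a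
-- graph containing L: a circulant C_N(±1, …, ±r) when a = 2r; K_{a+1} when b = 0; for a = 2r − 1
-- the circulant minus a perfect matching, with heavy graph the complement of that graph (N = a + b + 1)
-- or of the whole circulant (N = a + b + 2); for a = 2 a triangle plus a cycle C_b; and on six
-- vertices two triangles C₆(±2) with heavy graph the antipodal matching or the hexagon.

module Submission where

open import Defs
open import Data.Bool using (Bool; true; false; not; _∧_; _∨_; if_then_else_)
open import Data.Bool.Properties using (∨-zeroʳ; ∧-zeroʳ)
open import Data.Empty using (⊥-elim)
open import Data.Fin using (Fin; zero; suc; toℕ; fromℕ; inject₁)
open import Data.Fin.Patterns using (0F; 1F; 2F; 3F; 4F)
open import Data.Fin.Properties using (toℕ<n; toℕ-inject₁; toℕ-fromℕ) renaming (_≟_ to _≟ᶠ_)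
open import Data.List using (List; []; _∷_; length; map; tabulate; allFin)
open import Data.List.Membership.Propositional using (_∈_; _∉_)
open import Data.List.Properties using (map-tabulate)
open import Data.List.Relation.Unary.All as All using (All; []; _∷_)
open import Data.List.Relation.Unary.AllPairs using ([]; _∷_)
open import Data.List.Relation.Unary.Any using (here; there)
open import Data.List.Relation.Unary.Unique.Propositional using (Unique)
open import Data.Nat using (ℕ; NonZero; zero; suc; _+_; _*_; _∸_; _%_; _⊓_; ∣_-_∣; _≤_; _<_; z≤n; s≤s; s≤s⁻¹)
open import Data.Nat.DivMod using (m<n⇒m%n≡m; n%n≡0; %-distribˡ-+; %-distribˡ-*; m%n%n≡m%n; [m+n]%n≡m%n; [m+kn]%n≡m%n; m*n%n≡0)
import Data.Nat.ListAction as List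
open import Data.Nat.Properties
open import Data.Nat.Tactic.RingSolver using (solve-∀)
open import Algebra.Properties.CommutativeMonoid.Sum +-0-commutativeMonoid
  using (sum; sum-syntax; sum-cong-≗; ∑-distrib-+; sum-replicate-zero; sum-init-last)
open import Data.Product using (∃; _×_; _,_; proj₁; proj₂)
open import Data.Sum using (_⊎_; inj₁; inj₂)
open import Function using (_∘_; id; case_of_; mk⇔)
open import Relation.Nullary using (¬_; Dec; yes; no; does)
open import Relation.Nullary.Decidable using (dec-true; dec-false; does-⇔)
open import Relation.Binary.PropositionalEquality

𝟙 : Bool → ℕ
𝟙 true  = 1
𝟙 false = 0

𝟙≤1 : ∀ b → 𝟙 b ≤ 1
𝟙≤1 true  = s≤s z≤n
𝟙≤1 false = z≤n

1≤𝟙 : ∀ {b} → b ≡ true → 1 ≤ 𝟙 b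
1≤𝟙 refl = s≤s z≤n

sum-mono-≤ : ∀ {n} {f g : Fin n → ℕ} → (∀ i → f i ≤ g i) → sum f ≤ sum g
sum-mono-≤ {zero}  f≤g = z≤n
sum-mono-≤ {suc n} f≤g = +-mono-≤ (f≤g zero) (sum-mono-≤ (f≤g ∘ suc))

sum-const : ∀ n c → sum {n} (λ _ → c) ≡ n * c
sum-const zero    c = refl
sum-const (suc n) c = cong (c +_) (sum-const n c)

sum-ones : ∀ n → sum {n} (λ _ → 1) ≡ n
sum-ones n = trans (sum-const n 1) (*-identityʳ n)

sum-allFin : ∀ {n} (f : Fin n → ℕ) → List.sum (map f (allFin n)) ≡ sum f
sum-allFin f = trans (cong List.sum (map-tabulate id f)) (sum-tabulate f)
  where
  sum-tabulate : ∀ {n} (f : Fin n → ℕ) → List.sum (tabulate f) ≡ sum f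
  sum-tabulate {zero}  f = refl
  sum-tabulate {suc n} f = cong (f zero +_) (sum-tabulate (f ∘ suc))

sum-δ : ∀ {n} (p : Fin n) → sum (λ u → 𝟙 (does (p ≟ᶠ u))) ≡ 1
sum-δ {suc n} zero    = cong suc (sum-replicate-zero n)
sum-δ {suc n} (suc p) = sum-δ p

sum<n⇒∃≡0 : ∀ {n} (f : Fin n → ℕ) → sum f < n → ∃ λ u → f u ≡ 0
sum<n⇒∃≡0 {suc n} f sum<n with f zero in f0
... | zero  = zero , f0
... | suc m with u , fu≡0 ← sum<n⇒∃≡0 (f ∘ suc) (≤-trans (s≤s (m≤n+m _ m)) (s≤s⁻¹ sum<n))
            = suc u , fu≡0

sum-symmetric-even : ∀ n (f : Fin n → Fin n → ℕ) → (∀ u v → f u v ≡ f v u) → (∀ v → f v v ≡ 0) →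
                    ∃ λ m → sum (λ v → sum (f v)) ≡ m + m
sum-symmetric-even zero    f f-sym f-diag = 0 , refl
sum-symmetric-even (suc n) f f-sym f-diag
  with m , inner ← sum-symmetric-even n (λ u v → f (suc u) (suc v)) (λ u v → f-sym (suc u) (suc v)) (f-diag ∘ suc)
  = border + m , (begin
      f zero zero + border + sum (λ v → f (suc v) zero + sum (λ u → f (suc v) (suc u)))
    ≡⟨ cong₂ _+_ (cong (_+ border) (f-diag zero)) (∑-distrib-+ (λ v → f (suc v) zero) _) ⟩
      border + (sum (λ v → f (suc v) zero) + sum (λ v → sum (λ u → f (suc v) (suc u))))
    ≡⟨ cong₂ (λ s t → border + (s + t)) (sum-cong-≗ (λ v → f-sym (suc v) zero)) inner ⟩
      border + (border + (m + m))
    ≡⟨ regroup border m ⟩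
      border + m + (border + m) ∎)
  where
  open ≡-Reasoning
  border = sum (λ u → f zero (suc u))
  regroup : ∀ x y → x + (x + (y + y)) ≡ x + y + (x + y)
  regroup = solve-∀

occurrences : ∀ {n} → List (Fin n) → Fin n → ℕ
occurrences []       u = 0
occurrences (p ∷ ps) u = 𝟙 (does (p ≟ᶠ u)) + occurrences ps u

sum-occurrences : ∀ {n} (ps : List (Fin n)) → sum (occurrences ps) ≡ length ps
sum-occurrences {n} []   = sum-replicate-zero n
sum-occurrences (p ∷ ps) = trans (∑-distrib-+ _ (occurrences ps)) (cong₂ _+_ (sum-δ p) (sum-occurrences ps))

∈⇒1≤occurrences : ∀ {n} {u : Fin n} {ps} → u ∈ ps → 1 ≤ occurrences ps u
∈⇒1≤occurrences {u = u} (here refl) rewrite dec-true (u ≟ᶠ u) refl = s≤s z≤n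
∈⇒1≤occurrences {ps = p ∷ _} (there u∈ps) = ≤-trans (∈⇒1≤occurrences u∈ps) (m≤n+m _ (𝟙 (does (p ≟ᶠ _))))

occurrences-≢ : ∀ {n} {u : Fin n} ps → All (_≢ u) ps → occurrences ps u ≡ 0
occurrences-≢ []       []            = refl
occurrences-≢ (p ∷ ps) (p≢u ∷ ps≢u) rewrite dec-false (p ≟ᶠ _) p≢u = occurrences-≢ ps ps≢u

occurrences-unique : ∀ {n} {ps : List (Fin n)} → Unique ps → ∀ u →
                     occurrences ps u ≡ 0 ⊎ (occurrences ps u ≡ 1 × u ∈ ps)
occurrences-unique []                      u = inj₁ refl
occurrences-unique {ps = p ∷ ps} (p≢ps ∷ uniq) u with p ≟ᶠ u | occurrences-unique uniq u
... | yes refl | _                     = inj₂ (cong suc (occurrences-≢ ps (All.map (λ p≢q → p≢q ∘ sym) p≢ps)) , here refl)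
... | no _     | inj₁ occ≡0            = inj₁ occ≡0
... | no _     | inj₂ (occ≡1 , u∈ps)   = inj₂ (occ≡1 , there u∈ps)

length≤sum : ∀ {n} {f : Fin n → ℕ} {ps} → Unique ps → All (λ p → 1 ≤ f p) ps → length ps ≤ sum f
length≤sum {f = f} {ps} uniq f≥1 = subst (_≤ sum f) (sum-occurrences ps) (sum-mono-≤ occ≤f)
  where
  occ≤f : ∀ u → occurrences ps u ≤ f u
  occ≤f u with occurrences-unique uniq u
  ... | inj₁ occ≡0          rewrite occ≡0 = z≤n
  ... | inj₂ (occ≡1 , u∈ps) rewrite occ≡1 = All.lookup f≥1 u∈ps

sum+length≤n : ∀ {n} {f : Fin n → ℕ} {ps} → Unique ps → (∀ u → f u ≤ 1) → All (λ p → f p ≡ 0) ps →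
               sum f + length ps ≤ n
sum+length≤n {n} {f} {ps} uniq f≤1 f≡0 = begin
  sum f + length ps                        ≡⟨ cong (sum f +_) (sum-occurrences ps) ⟨
  sum f + sum (occurrences ps)             ≡⟨ ∑-distrib-+ f (occurrences ps) ⟨
  sum (λ u → f u + occurrences ps u)       ≤⟨ sum-mono-≤ f+occ≤1 ⟩
  sum {n} (λ _ → 1)                        ≡⟨ sum-ones n ⟩
  n                                        ∎
  where
  open ≤-Reasoning
  f+occ≤1 : ∀ u → f u + occurrences ps u ≤ 1
  f+occ≤1 u with occurrences-unique uniq u
  ... | inj₁ occ≡0          rewrite occ≡0 | +-identityʳ (f u) = f≤1 u
  ... | inj₂ (occ≡1 , u∈ps) rewrite occ≡1 | All.lookup f≡0 u∈ps = s≤s z≤n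

∃∉ : ∀ {n} (ps : List (Fin n)) → length ps < n → ∃ λ w → w ∉ ps
∃∉ ps short with w , occ≡0 ← sum<n⇒∃≡0 (occurrences ps) (subst (_< _) (sym (sum-occurrences ps)) short)
  = w , λ w∈ps → case subst (1 ≤_) occ≡0 (∈⇒1≤occurrences w∈ps) of λ ()

-- Girth 3 and light triangles
weight-positive : ∀ l h → (l ∨ h) ≡ true → 1 ≤ (if l then 1 else (if h then 2 else 0))
weight-positive true  _    _ = s≤s z≤n
weight-positive false true _ = s≤s z≤n

light⊎heavy-weight : ∀ l h → (l ∨ h) ≡ true → l ≡ true ⊎ 2 ≤ (if l then 1 else (if h then 2 else 0))
light⊎heavy-weight true  _    _ = inj₁ refl
light⊎heavy-weight false true _ = inj₂ ≤-refl

record LightTriangle {n} (G : WGraph n) : Set where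
  constructor lightTriangle
  field
    x y z : Fin n
    x≢y   : x ≢ y
    x≢z   : x ≢ z
    y≢z   : y ≢ z
    xy    : WGraph.L G x y ≡ true
    yz    : WGraph.L G y z ≡ true
    zx    : WGraph.L G z x ≡ true

module _ {n : ℕ} (G : WGraph n) where
  open WGraph G

  AdjacentCycle : List (Fin n) → Set
  AdjacentCycle vs = All (λ e → Adj G (proj₁ e) (proj₂ e)) (cycEdges vs)

  cycleWeight : List (Fin n) → ℕ
  cycleWeight vs = List.sum (map (λ e → w G (proj₁ e) (proj₂ e)) (cycEdges vs))

  1≤w : ∀ {u v} → Adj G u v → 1 ≤ w G u v
  1≤w {u} {v} = weight-positive (L u v) (H u v)

  4≤cycleWeight : ∀ x y z r rs → AdjacentCycle (x ∷ y ∷ z ∷ r ∷ rs) → 4 ≤ cycleWeight (x ∷ y ∷ z ∷ r ∷ rs)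
  4≤cycleWeight x y z r []      (a₁ ∷ a₂ ∷ a₃ ∷ a₄ ∷ []) = +-mono-≤ (1≤w a₁) (+-mono-≤ (1≤w a₂) (+-mono-≤ (1≤w a₃) (+-mono-≤ (1≤w a₄) z≤n)))
  4≤cycleWeight x y z r (_ ∷ _) (a₁ ∷ a₂ ∷ a₃ ∷ a₄ ∷ _)  = +-mono-≤ (1≤w a₁) (+-mono-≤ (1≤w a₂) (+-mono-≤ (1≤w a₃) (+-mono-≤ (1≤w a₄) z≤n)))

  3≤cycleWeight : ∀ vs → 3 ≤ length vs → AdjacentCycle vs → 3 ≤ cycleWeight vs
  3≤cycleWeight (x ∷ [])             (s≤s ())
  3≤cycleWeight (x ∷ y ∷ [])         (s≤s (s≤s ()))
  3≤cycleWeight (x ∷ y ∷ z ∷ [])     _ (a₁ ∷ a₂ ∷ a₃ ∷ []) = +-mono-≤ (1≤w a₁) (+-mono-≤ (1≤w a₂) (+-mono-≤ (1≤w a₃) z≤n))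
  3≤cycleWeight (x ∷ y ∷ z ∷ r ∷ rs) _ adj                 = ≤-trans (n≤1+n 3) (4≤cycleWeight x y z r rs adj)

  weight3⇒light : ∀ {x y z} → AdjacentCycle (x ∷ y ∷ z ∷ []) → cycleWeight (x ∷ y ∷ z ∷ []) ≡ 3 →
                  L x y ≡ true × L y z ≡ true × L z x ≡ true
  weight3⇒light {x} {y} {z} (a₁ ∷ a₂ ∷ a₃ ∷ []) weight≡3
    with light⊎heavy-weight (L x y) (H x y) a₁ | light⊎heavy-weight (L y z) (H y z) a₂ | light⊎heavy-weight (L z x) (H z x) a₃
  ... | inj₁ l₁ | inj₁ l₂ | inj₁ l₃ = l₁ , l₂ , l₃
  ... | inj₂ h₁ | _       | _       = ⊥-elim (<-irrefl (sym weight≡3) (+-mono-≤ h₁ (+-mono-≤ (1≤w a₂) (+-mono-≤ (1≤w a₃) z≤n))))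
  ... | _       | inj₂ h₂ | _       = ⊥-elim (<-irrefl (sym weight≡3) (+-mono-≤ (1≤w a₁) (+-mono-≤ h₂ (+-mono-≤ (1≤w a₃) z≤n))))
  ... | _       | _       | inj₂ h₃ = ⊥-elim (<-irrefl (sym weight≡3) (+-mono-≤ (1≤w a₁) (+-mono-≤ (1≤w a₂) (+-mono-≤ h₃ z≤n))))

  girth3⇒lightTriangle : HasGirth G 3 → LightTriangle G
  girth3⇒lightTriangle ((c , weight≡3) , _) = fromCycle (WCycle.verts c) (WCycle.long c) (WCycle.distinct c) (WCycle.adjacent c) weight≡3
    where
    fromCycle : ∀ vs → 3 ≤ length vs → Unique vs → AdjacentCycle vs → cycleWeight vs ≡ 3 → LightTriangle G
    fromCycle (x ∷ [])             (s≤s ())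
    fromCycle (x ∷ y ∷ [])         (s≤s (s≤s ()))
    fromCycle (x ∷ y ∷ z ∷ [])     _ ((x≢y ∷ x≢z ∷ []) ∷ (y≢z ∷ []) ∷ [] ∷ []) adj weight≡3
      with xy , yz , zx ← weight3⇒light adj weight≡3
      = lightTriangle x y z x≢y x≢z y≢z xy yz zx
    fromCycle (x ∷ y ∷ z ∷ r ∷ rs) _ _ adj weight≡3 = ⊥-elim (<-irrefl (sym weight≡3) (4≤cycleWeight x y z r rs adj))

  lightTriangle⇒girth3 : LightTriangle G → HasGirth G 3
  lightTriangle⇒girth3 t = (triangle , weight≡3) , λ c → 3≤cycleWeight (WCycle.verts c) (WCycle.long c) (WCycle.adjacent c)
    where
    open LightTriangle t
    light⇒adj : ∀ {u v} → L u v ≡ true → Adj G u v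
    light⇒adj {u} {v} luv = cong (_∨ H u v) luv
    triangle : WCycle G
    triangle = record
      { verts    = x ∷ y ∷ z ∷ []
      ; long     = ≤-refl
      ; distinct = (x≢y ∷ x≢z ∷ []) ∷ (y≢z ∷ []) ∷ [] ∷ []
      ; adjacent = light⇒adj xy ∷ light⇒adj yz ∷ light⇒adj zx ∷ []
      }
    weight≡3 : weight G triangle ≡ 3
    weight≡3 rewrite xy | yz | zx = refl

-- Lower bounds on the order
module _ {n : ℕ} (G : WGraph n) where
  open WGraph G

  indicator≡𝟙 : ∀ b → indicator G b ≡ 𝟙 b
  indicator≡𝟙 true  = refl
  indicator≡𝟙 false = refl

  degL≡ : ∀ v → degL G v ≡ sum (λ u → 𝟙 (L v u))
  degL≡ v = trans (sum-allFin (λ u → indicator G (L v u))) (sum-cong-≗ (λ u → indicator≡𝟙 (L v u)))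

  degH≡ : ∀ v → degH G v ≡ sum (λ u → 𝟙 (H v u))
  degH≡ v = trans (sum-allFin (λ u → indicator G (H v u))) (sum-cong-≗ (λ u → indicator≡𝟙 (H v u)))

  degL+degH+1≤n : ∀ v → degL G v + degH G v + 1 ≤ n
  degL+degH+1≤n v = begin
    degL G v + degH G v + 1                        ≡⟨ cong₂ (λ l h → l + h + 1) (degL≡ v) (degH≡ v) ⟩
    sum (λ u → 𝟙 (L v u)) + sum (λ u → 𝟙 (H v u)) + 1 ≡⟨ cong (_+ 1) (∑-distrib-+ (λ u → 𝟙 (L v u)) _) ⟨
    sum (λ u → 𝟙 (L v u) + 𝟙 (H v u)) + 1          ≤⟨ sum+length≤n ([] ∷ []) at-most-one (not-self ∷ []) ⟩
    n                                              ∎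
    where
    open ≤-Reasoning
    at-most-one : ∀ u → 𝟙 (L v u) + 𝟙 (H v u) ≤ 1
    at-most-one u with L v u in lvu
    ... | true rewrite disjoint v u lvu = ≤-refl
    ... | false = 𝟙≤1 (H v u)
    not-self : 𝟙 (L v v) + 𝟙 (H v v) ≡ 0
    not-self rewrite L-irr v | H-irr v = refl

  neighbours≤degL : ∀ {v ps} → Unique ps → All (λ u → L v u ≡ true) ps → length ps ≤ degL G v
  neighbours≤degL {v} uniq adj = subst (_ ≤_) (sym (degL≡ v)) (length≤sum uniq (All.map 1≤𝟙 adj))

  2≤degL : (t : LightTriangle G) → 2 ≤ degL G (LightTriangle.x t)
  2≤degL t = neighbours≤degL ((y≢z ∷ []) ∷ [] ∷ []) (xy ∷ trans (L-sym x z) zx ∷ [])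
    where open LightTriangle t

  2-regular⇒6≤n : (∀ v → degL G v ≡ 2) → LightTriangle G → 4 ≤ n → 6 ≤ n
  2-regular⇒6≤n 2-regular t 4≤n = outside (∃∉ (x ∷ y ∷ z ∷ []) 4≤n)
    where
    open LightTriangle t
    outside : (∃ λ w → w ∉ x ∷ y ∷ z ∷ []) → 6 ≤ n
    outside (w , w∉xyz) = begin
      6                         ≡⟨ cong (_+ 4) (2-regular w) ⟨
      degL G w + 4              ≡⟨ cong (_+ 4) (degL≡ w) ⟩
      sum (λ u → 𝟙 (L w u)) + 4 ≤⟨ sum+length≤n distinct (𝟙≤1 ∘ L w) (cong 𝟙 (L-irr w) ∷ x≁w ∷ y≁w ∷ z≁w ∷ []) ⟩
      n                         ∎
      where
      open ≤-Reasoning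
      w≢x : w ≢ x
      w≢x = w∉xyz ∘ here
      w≢y : w ≢ y
      w≢y = w∉xyz ∘ there ∘ here
      w≢z : w ≢ z
      w≢z = w∉xyz ∘ there ∘ there ∘ here
      distinct : Unique (w ∷ x ∷ y ∷ z ∷ [])
      distinct = (w≢x ∷ w≢y ∷ w≢z ∷ []) ∷ (x≢y ∷ x≢z ∷ []) ∷ (y≢z ∷ []) ∷ [] ∷ []
      not-adjacent : ∀ {c p q} → p ≢ q → w ≢ p → w ≢ q → L c p ≡ true → L c q ≡ true → 𝟙 (L w c) ≡ 0
      not-adjacent {c} p≢q w≢p w≢q cp cq rewrite L-sym w c with L c w in cw
      ... | false = refl
      ... | true  = ⊥-elim (<-irrefl (sym (2-regular c))
                      (neighbours≤degL ((p≢q ∷ (w≢p ∘ sym) ∷ []) ∷ ((w≢q ∘ sym) ∷ []) ∷ [] ∷ []) (cp ∷ cq ∷ cw ∷ [])))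
      x≁w : 𝟙 (L w x) ≡ 0
      x≁w = not-adjacent y≢z w≢y w≢z xy (trans (L-sym x z) zx)
      y≁w : 𝟙 (L w y) ≡ 0
      y≁w = not-adjacent x≢z w≢x w≢z (trans (L-sym y x) xy) yz
      z≁w : 𝟙 (L w z) ≡ 0
      z≁w = not-adjacent x≢y w≢x w≢y zx (trans (L-sym z y) yz)

  regular⇒n*a-even : ∀ {a b} → Regular G a b → ∃ λ m → n * a ≡ m + m
  regular⇒n*a-even {a} regular
    with m , double ← sum-symmetric-even n (λ v u → 𝟙 (L v u)) (λ u v → cong 𝟙 (L-sym u v)) (cong 𝟙 ∘ L-irr)
    = m , (begin
      n * a                          ≡⟨ sum-const n a ⟨
      sum {n} (λ _ → a)              ≡⟨ sum-cong-≗ (λ v → trans (sym (proj₁ (regular v))) (degL≡ v)) ⟩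
      sum (λ v → sum (λ u → 𝟙 (L v u))) ≡⟨ double ⟩
      m + m                          ∎)
    where open ≡-Reasoning

module _ {a b k : ℕ} where

  realizable⇒2≤a : Realizable a b 3 k → 2 ≤ a
  realizable⇒2≤a (G , regular , girth3) = subst (2 ≤_) (proj₁ (regular (LightTriangle.x t))) (2≤degL G t)
    where t = girth3⇒lightTriangle G girth3

  realizable⇒a+b+1≤k : Realizable a b 3 k → a + b + 1 ≤ k
  realizable⇒a+b+1≤k (G , regular , girth3) =
    subst₂ (λ l h → l + h + 1 ≤ k) (proj₁ (regular v)) (proj₂ (regular v)) (degL+degH+1≤n G v)
    where v = LightTriangle.x (girth3⇒lightTriangle G girth3)

realizable-2⇒6≤k : ∀ {b k} → 1 ≤ b → Realizable 2 b 3 k → 6 ≤ k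
realizable-2⇒6≤k 1≤b R@(G , regular , girth3) =
  2-regular⇒6≤n G (proj₁ ∘ regular) (girth3⇒lightTriangle G girth3)
    (≤-trans (+-monoˡ-≤ 1 (+-monoʳ-≤ 2 1≤b)) (realizable⇒a+b+1≤k R))

minOrderIs : ∀ {a b m} → Realizable a b 3 m → (∀ {k} → Realizable a b 3 k → m ≤ k) → MinOrderIs a b 3 m
minOrderIs R lower = R , λ k k<m R′ → <⇒≱ k<m (lower R′)

data Parity : ℕ → Set where
  even : ∀ k → Parity (k + k)
  odd  : ∀ k → Parity (suc (k + k))

parity : ∀ n → Parity n
parity zero = even zero
parity (suc n) with parity n
... | even k = odd k
... | odd k  = subst (Parity ∘ suc) (+-suc k k) (even (suc k))

even%2 : ∀ k → (k + k) % 2 ≡ 0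
even%2 k = trans (cong (_% 2) (k+k≡k*2 k)) (m*n%n≡0 k 2)
  where
  k+k≡k*2 : ∀ k → k + k ≡ k * 2
  k+k≡k*2 = solve-∀

odd%2 : ∀ k → suc (k + k) % 2 ≡ 1
odd%2 k = trans (cong (_% 2) (1+k+k≡1+k*2 k)) ([m+kn]%n≡m%n 1 k 2)
  where
  1+k+k≡1+k*2 : ∀ k → suc (k + k) ≡ 1 + k * 2
  1+k+k≡1+k*2 = solve-∀

even*%2 : ∀ k n → ((k + k) * n) % 2 ≡ 0
even*%2 k n = trans (%-distribˡ-* (k + k) n 2) (cong (λ e → (e * (n % 2)) % 2) (even%2 k))

*even%2 : ∀ n k → (n * (k + k)) % 2 ≡ 0
*even%2 n k = trans (cong (_% 2) (*-comm n (k + k))) (even*%2 k n)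

odd*odd%2 : ∀ i j → (suc (i + i) * suc (j + j)) % 2 ≡ 1
odd*odd%2 i j = trans (%-distribˡ-* (suc (i + i)) (suc (j + j)) 2) (cong₂ (λ x y → (x * y) % 2) (odd%2 i) (odd%2 j))

¬realizable-odd-odd-a+b+1 : ∀ i j → let a = suc (i + i); b = suc (j + j) in ¬ Realizable a b 3 (a + b + 1)
¬realizable-odd-odd-a+b+1 i j (G , regular , _) with m , k*a≡m+m ← regular⇒n*a-even G regular = case (begin
    1                                                           ≡⟨ odd*odd%2 (i + j + 1) i ⟨
    (suc ((i + j + 1) + (i + j + 1)) * suc (i + i)) % 2         ≡⟨ cong (λ k → (k * suc (i + i)) % 2) (k≡odd i j) ⟨
    ((suc (i + i) + suc (j + j) + 1) * suc (i + i)) % 2         ≡⟨ cong (_% 2) k*a≡m+m ⟩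
    (m + m) % 2                                                 ≡⟨ even%2 m ⟩
    0                                                           ∎) of λ ()
  where
  open ≡-Reasoning
  k≡odd : ∀ i j → suc (i + i) + suc (j + j) + 1 ≡ suc ((i + j + 1) + (i + j + 1))
  k≡odd = solve-∀

realizable-odd-odd⇒a+b+2≤k : ∀ i j {k} → let a = suc (i + i); b = suc (j + j) in Realizable a b 3 k → a + b + 2 ≤ k
realizable-odd-odd⇒a+b+2≤k i j {k} R = subst (_≤ k) (sym (+-suc (suc (i + i) + suc (j + j)) 1))
  (≤∧≢⇒< (realizable⇒a+b+1≤k R) λ { refl → ¬realizable-odd-odd-a+b+1 i j R })

sum-toℕ-δ : ∀ {n x} → x < n → sum {n} (λ j → 𝟙 (does (x ≟ toℕ j))) ≡ 1
sum-toℕ-δ {suc n} {zero}  _       = cong suc (sum-replicate-zero n)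
sum-toℕ-δ {suc n} {suc x} (s≤s x<n) = sum-toℕ-δ x<n

sum-toℕ-+ : ∀ m k (g : ℕ → ℕ) → sum {m + k} (g ∘ toℕ) ≡ sum {m} (g ∘ toℕ) + sum {k} (λ j → g (m + toℕ j))
sum-toℕ-+ zero    k g = refl
sum-toℕ-+ (suc m) k g = trans (cong (g 0 +_) (sum-toℕ-+ m k (g ∘ suc))) (sym (+-assoc (g 0) _ _))

degree : ℕ → (ℕ → ℕ → Bool) → ℕ → ℕ
degree n κ x = ∑[ j < n ] 𝟙 (κ x (toℕ j))

complement : (ℕ → ℕ → Bool) → ℕ → ℕ → Bool
complement κ x y = not (κ x y ∨ does (x ≟ y))

complement-sym : ∀ {κ} → (∀ x y → κ x y ≡ κ y x) → ∀ x y → complement κ x y ≡ complement κ y x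
complement-sym κ-sym x y = cong₂ (λ k e → not (k ∨ e)) (κ-sym x y) (does-⇔ (mk⇔ sym sym) (x ≟ y) (y ≟ x))

complement-irr : ∀ κ x → complement κ x x ≡ false
complement-irr κ x = trans (cong (λ e → not (κ x x ∨ e)) (dec-true (x ≟ x) refl)) (cong not (∨-zeroʳ (κ x x)))

complement-disjoint : ∀ κ {x y} → κ x y ≡ true → complement κ x y ≡ false
complement-disjoint κ κxy rewrite κxy = refl

complement-degree : ∀ {n x} κ → x < n → κ x x ≡ false → degree n κ x + degree n (complement κ) x + 1 ≡ n
complement-degree {n} {x} κ x<n κxx = begin
  degree n κ x + degree n (complement κ) x + 1
    ≡⟨ cong₂ _+_ (∑-distrib-+ {n} (λ j → 𝟙 (κ x (toℕ j))) _) (sum-toℕ-δ x<n) ⟨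
  ∑[ j < n ] (𝟙 (κ x (toℕ j)) + 𝟙 (complement κ x (toℕ j))) + ∑[ j < n ] 𝟙 (does (x ≟ toℕ j))
    ≡⟨ ∑-distrib-+ {n} (λ j → 𝟙 (κ x (toℕ j)) + 𝟙 (complement κ x (toℕ j))) _ ⟨
  ∑[ j < n ] (𝟙 (κ x (toℕ j)) + 𝟙 (complement κ x (toℕ j)) + 𝟙 (does (x ≟ toℕ j)))
    ≡⟨ sum-cong-≗ {n} (λ j → partition (κ x (toℕ j)) (x ≟ toℕ j) loopless) ⟩
  sum {n} (λ _ → 1)
    ≡⟨ sum-ones n ⟩
  n ∎
  where
  open ≡-Reasoning
  partition : ∀ k {P} (e : Dec P) → (P → k ≡ false) → 𝟙 k + 𝟙 (not (k ∨ does e)) + 𝟙 (does e) ≡ 1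
  partition true  (yes p) p⇒¬k = case p⇒¬k p of λ ()
  partition true  (no _)  _    = refl
  partition false (yes _) _    = refl
  partition false (no _)  _    = refl
  loopless : ∀ {y} → x ≡ y → κ x y ≡ false
  loopless refl = κxx

-- H is described by its complement notHeavy ⊇ L, so that deg_H = n − 1 − deg_notHeavy.
record WGraphOnℕ : Set where
  field
    light notHeavy : ℕ → ℕ → Bool
    light-sym      : ∀ x y → light x y ≡ light y x
    notHeavy-sym   : ∀ x y → notHeavy x y ≡ notHeavy y x
    notHeavy-irr   : ∀ x → notHeavy x x ≡ false
    light⇒notHeavy : ∀ {x y} → light x y ≡ true → notHeavy x y ≡ true

  heavy : ℕ → ℕ → Bool
  heavy = complement notHeavy

  light-irr : ∀ x → light x x ≡ false
  light-irr x with light x x in lxx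
  ... | false = refl
  ... | true  = case trans (sym (light⇒notHeavy lxx)) (notHeavy-irr x) of λ ()

  restrict : (n : ℕ) → WGraph n
  restrict n = record
    { L        = λ u v → light (toℕ u) (toℕ v)
    ; H        = λ u v → heavy (toℕ u) (toℕ v)
    ; L-sym    = λ u v → light-sym (toℕ u) (toℕ v)
    ; H-sym    = λ u v → complement-sym notHeavy-sym (toℕ u) (toℕ v)
    ; L-irr    = λ v → light-irr (toℕ v)
    ; H-irr    = λ v → complement-irr notHeavy (toℕ v)
    ; disjoint = λ u v → complement-disjoint notHeavy ∘ light⇒notHeavy
    }

  realizable : ∀ {n a b} → (∀ {x} → x < n → degree n light x ≡ a) →
               (∀ {x} → x < n → degree n notHeavy x + b + 1 ≡ n) →
               LightTriangle (restrict n) → Realizable a b 3 n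
  realizable {n} {a} {b} light-degree notHeavy-degree t =
    restrict n , regular , lightTriangle⇒girth3 (restrict n) t
    where
    heavy-degree : ∀ {x} → x < n → degree n heavy x ≡ b
    heavy-degree {x} x<n = +-cancelˡ-≡ (degree n notHeavy x) _ _ (+-cancelʳ-≡ 1 _ _
      (trans (complement-degree notHeavy x<n (notHeavy-irr x)) (sym (notHeavy-degree x<n))))
    regular : Regular (restrict n) a b
    regular v = trans (degL≡ (restrict n) v) (light-degree (toℕ<n v))
              , trans (degH≡ (restrict n) v) (heavy-degree (toℕ<n v))

withComplement : (κ : ℕ → ℕ → Bool) → (∀ x y → κ x y ≡ κ y x) → (∀ x → κ x x ≡ false) → WGraphOnℕ
withComplement κ κ-sym κ-irr = record
  { light = κ ; notHeavy = κ ; light-sym = κ-sym ; notHeavy-sym = κ-sym ; notHeavy-irr = κ-irr ; light⇒notHeavy = λ κxy → κxy }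

withComplement-realizable : ∀ κ κ-sym κ-irr {n a b} → (∀ {x} → x < n → degree n κ x ≡ a) → a + b + 1 ≡ n →
                            LightTriangle (WGraphOnℕ.restrict (withComplement κ κ-sym κ-irr) n) → Realizable a b 3 n
withComplement-realizable κ κ-sym κ-irr {n} {a} {b} κ-degree a+b+1≡n =
  WGraphOnℕ.realizable (withComplement κ κ-sym κ-irr) κ-degree (λ x<n → trans (cong (λ d → d + b + 1) (κ-degree x<n)) a+b+1≡n)

-- Circulants
[m%n+k]%n≡[m+k]%n : ∀ m k n .{{_ : NonZero n}} → (m % n + k) % n ≡ (m + k) % n
[m%n+k]%n≡[m+k]%n m k n = begin
  (m % n + k) % n           ≡⟨ %-distribˡ-+ (m % n) k n ⟩
  (m % n % n + k % n) % n   ≡⟨ cong (λ r → (r + k % n) % n) (m%n%n≡m%n m n) ⟩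
  (m % n + k % n) % n       ≡⟨ %-distribˡ-+ m k n ⟨
  (m + k) % n               ∎
  where open ≡-Reasoning

sum-rotate₁ : ∀ n (g : ℕ → ℕ) → sum {suc n} (λ j → g ((toℕ j + 1) % suc n)) ≡ sum {suc n} (g ∘ toℕ)
sum-rotate₁ n g = begin
  sum rotated                      ≡⟨ sum-init-last rotated ⟩
  sum (rotated ∘ inject₁) + rotated (fromℕ n)
                                   ≡⟨ cong₂ _+_ (sum-cong-≗ (λ j → cong g (below (toℕ j) (toℕ-inject₁ j) (toℕ<n j)))) (cong g wrap) ⟩
  sum {n} (λ j → g (suc (toℕ j))) + g 0 ≡⟨ +-comm _ (g 0) ⟩
  sum {suc n} (g ∘ toℕ)            ∎
  where
  open ≡-Reasoning
  rotated : Fin (suc n) → ℕ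
  rotated j = g ((toℕ j + 1) % suc n)
  below : ∀ {i} y → i ≡ y → y < n → (i + 1) % suc n ≡ suc y
  below y refl y<n = trans (m<n⇒m%n≡m (subst (_< suc n) (+-comm 1 y) (s≤s y<n))) (+-comm y 1)
  wrap : (toℕ (fromℕ n) + 1) % suc n ≡ 0
  wrap = trans (cong (λ m → (m + 1) % suc n) (toℕ-fromℕ n)) (trans (cong (_% suc n) (+-comm n 1)) (n%n≡0 (suc n)))

sum-rotate : ∀ n (g : ℕ → ℕ) x → sum {suc n} (λ j → g ((toℕ j + x) % suc n)) ≡ sum {suc n} (g ∘ toℕ)
sum-rotate n g zero    = sum-cong-≗ (λ j → cong g (trans (cong (_% suc n) (+-identityʳ (toℕ j))) (m<n⇒m%n≡m (toℕ<n j))))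
sum-rotate n g (suc x) = begin
  ∑[ j < suc n ] g ((toℕ j + suc x) % suc n)           ≡⟨ sum-cong-≗ {suc n} (λ j → cong g (step (toℕ j))) ⟩
  ∑[ j < suc n ] g (((toℕ j + 1) % suc n + x) % suc n) ≡⟨ sum-rotate₁ n (λ y → g ((y + x) % suc n)) ⟩
  ∑[ j < suc n ] g ((toℕ j + x) % suc n)               ≡⟨ sum-rotate n g x ⟩
  ∑[ j < suc n ] g (toℕ j)                             ∎
  where
  open ≡-Reasoning
  step : ∀ y → (y + suc x) % suc n ≡ ((y + 1) % suc n + x) % suc n
  step y = sym (trans ([m%n+k]%n≡[m+k]%n (y + 1) x (suc n)) (cong (_% suc n) (+-assoc y 1 x)))

circDist : ℕ → ℕ → ℕ → ℕ
circDist N x y = ∣ x - y ∣ ⊓ (N ∸ ∣ x - y ∣)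

circulant : ℕ → (ℕ → Bool) → ℕ → ℕ → Bool
circulant N D x y = D (circDist N x y)

circulant-sym : ∀ N D x y → circulant N D x y ≡ circulant N D y x
circulant-sym N D x y rewrite ∣-∣-comm x y = refl

circulant-irr : ∀ N D → D 0 ≡ false → ∀ x → circulant N D x x ≡ false
circulant-irr N D D0 x rewrite ∣n-n∣≡0 x = D0

circDist-rotate : ∀ {N x j} .{{_ : NonZero N}} → x < N → j < N → circDist N x ((j + x) % N) ≡ j ⊓ (N ∸ j)
circDist-rotate {N@(suc _)} {x} {j} x<N j<N with j + x <? N
... | yes j+x<N rewrite m<n⇒m%n≡m j+x<N | +-comm j x | ∣m-m+n∣≡n x j = refl
... | no  j+x≮N = begin
  circDist N x ((j + x) % N) ≡⟨ cong (circDist N x) wrapped ⟩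
  circDist N x (x ∸ d)       ≡⟨ cong (λ e → e ⊓ (N ∸ e)) (trans (m≤n⇒∣n-m∣≡n∸m (m∸n≤m x d)) (m∸[m∸n]≡n d≤x)) ⟩
  d ⊓ (N ∸ d)                ≡⟨ cong (d ⊓_) (m∸[m∸n]≡n (<⇒≤ j<N)) ⟩
  d ⊓ j                      ≡⟨ ⊓-comm d j ⟩
  j ⊓ (N ∸ j)                ∎
  where
  open ≡-Reasoning
  d = N ∸ j
  j+d≡N : j + d ≡ N
  j+d≡N = m+[n∸m]≡n (<⇒≤ j<N)
  d≤x : d ≤ x
  d≤x = +-cancelˡ-≤ j d x (subst (_≤ j + x) (sym j+d≡N) (≮⇒≥ j+x≮N))
  wrapped : (j + x) % N ≡ x ∸ d
  wrapped = begin
    (j + x) % N           ≡⟨ cong (λ e → (j + e) % N) (m+[n∸m]≡n d≤x) ⟨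
    (j + (d + (x ∸ d))) % N ≡⟨ cong (_% N) (trans (sym (+-assoc j d (x ∸ d))) (cong (_+ (x ∸ d)) j+d≡N)) ⟩
    (N + (x ∸ d)) % N     ≡⟨ cong (_% N) (+-comm N (x ∸ d)) ⟩
    (x ∸ d + N) % N       ≡⟨ [m+n]%n≡m%n (x ∸ d) N ⟩
    (x ∸ d) % N           ≡⟨ m<n⇒m%n≡m (≤-<-trans (m∸n≤m x d) x<N) ⟩
    x ∸ d                 ∎

-- Substituting y = j + x (mod N) moves the neighbourhood of x to that of 0.
circulant-degree : ∀ {N x} D → x < N → degree N (circulant N D) x ≡ ∑[ j < N ] 𝟙 (D (toℕ j ⊓ (N ∸ toℕ j)))
circulant-degree {N@(suc n)} {x} D x<N = begin
  degree N (circulant N D) x                        ≡⟨ sum-rotate n (λ y → 𝟙 (circulant N D x y)) x ⟨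
  ∑[ j < N ] 𝟙 (circulant N D x ((toℕ j + x) % N)) ≡⟨ sum-cong-≗ {N} (λ j → cong (𝟙 ∘ D) (circDist-rotate x<N (toℕ<n j))) ⟩
  ∑[ j < N ] 𝟙 (D (toℕ j ⊓ (N ∸ toℕ j)))            ∎
  where open ≡-Reasoning

within : ℕ → ℕ → Bool
within r t = does (1 ≤? t) ∧ does (t ≤? r)

within-true : ∀ {r t} → 1 ≤ t → t ≤ r → within r t ≡ true
within-true {r} {t} 1≤t t≤r = cong₂ _∧_ (dec-true (1 ≤? t) 1≤t) (dec-true (t ≤? r) t≤r)

within-false : ∀ {r t} → r < t → within r t ≡ false
within-false {r} {t} r<t = trans (cong (does (1 ≤? t) ∧_) (dec-false (t ≤? r) (<⇒≱ r<t))) (∧-zeroʳ _)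

-- Among 0 < j < N, the first r and the last r positions are at circular distance 1, …, r from 0
-- and the middle ones are further away.
within-count : ∀ {N} r → r + r < N → ∑[ j < N ] 𝟙 (within r (toℕ j ⊓ (N ∸ toℕ j))) ≡ r + r
within-count {N} r 2r<N =
  subst (λ M → ∑[ j < M ] 𝟙 (within r (toℕ j ⊓ (M ∸ toℕ j))) ≡ r + r) M≡N (count (N ∸ suc (r + r)))
  where
  M≡N : suc (r + ((N ∸ suc (r + r)) + r)) ≡ N
  M≡N = trans (cong suc (trans (cong (r +_) (+-comm _ r)) (sym (+-assoc r r _)))) (m+[n∸m]≡n 2r<N)
  count : ∀ c → ∑[ j < suc (r + (c + r)) ] 𝟙 (within r (toℕ j ⊓ (suc (r + (c + r)) ∸ toℕ j))) ≡ r + r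
  count c = begin
    ∑[ j < M ] g (toℕ j)
      ≡⟨ sum-toℕ-+ r (c + r) (g ∘ suc) ⟩
    ∑[ i < r ] g (suc (toℕ i)) + ∑[ i < c + r ] g (suc (r + toℕ i))
      ≡⟨ cong (∑[ i < r ] g (suc (toℕ i)) +_) (sum-toℕ-+ c r (λ i → g (suc (r + i)))) ⟩
    ∑[ i < r ] g (suc (toℕ i)) + (∑[ i < c ] g (suc (r + toℕ i)) + ∑[ i < r ] g (suc (r + (c + toℕ i))))
      ≡⟨ cong₂ _+_ (sum-cong-≗ {r} (rising ∘ toℕ<n)) (cong₂ _+_ (sum-cong-≗ {c} (gap ∘ toℕ<n)) (sum-cong-≗ {r} (falling ∘ toℕ<n))) ⟩
    sum {r} (λ _ → 1) + (sum {c} (λ _ → 0) + sum {r} (λ _ → 1))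
      ≡⟨ cong₂ _+_ (sum-ones r) (cong₂ _+_ (sum-replicate-zero c) (sum-ones r)) ⟩
    r + r ∎
    where
    open ≡-Reasoning
    M = suc (r + (c + r))
    g : ℕ → ℕ
    g j = 𝟙 (within r (j ⊓ (M ∸ j)))
    rising : ∀ {i} → i < r → g (suc i) ≡ 1
    rising {i} i<r = cong 𝟙 (within-true (⊓-glb (s≤s z≤n) (m<n⇒0<n∸m (≤-trans i<r (m≤m+n r (c + r))))) (m≤n⇒m⊓o≤n _ i<r))
    gap : ∀ {i} → i < c → g (suc (r + i)) ≡ 0
    gap {i} i<c = cong 𝟙 (within-false (⊓-glb (s≤s (m≤m+n r i)) r<M∸j))
      where
      r<M∸j : r < M ∸ suc (r + i)
      r<M∸j = subst (r <_) (sym (trans ([m+n]∸[m+o]≡n∸o r (c + r) i) (+-∸-comm r (<⇒≤ i<c)))) (+-monoˡ-≤ r (m<n⇒0<n∸m i<c))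
    falling : ∀ {i} → i < r → g (suc (r + (c + i))) ≡ 1
    falling {i} i<r = cong 𝟙 (within-true (⊓-glb (s≤s z≤n) (subst (1 ≤_) (sym M∸j≡r∸i) (m<n⇒0<n∸m i<r)))
                                            (m≤n⇒o⊓m≤n _ (subst (_≤ r) (sym M∸j≡r∸i) (m∸n≤m r i))))
      where
      M∸j≡r∸i : M ∸ suc (r + (c + i)) ≡ r ∸ i
      M∸j≡r∸i = trans ([m+n]∸[m+o]≡n∸o r (c + r) (c + i)) ([m+n]∸[m+o]≡n∸o c r i)

-- Removing a perfect matching
withoutMatching : (ℕ → ℕ → Bool) → (ℕ → ℕ) → ℕ → ℕ → Bool
withoutMatching κ p x y = κ x y ∧ not (does (p x ≟ y))

withoutMatching-sym : ∀ {κ p} → (∀ x y → κ x y ≡ κ y x) → (∀ x → p (p x) ≡ x) →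
                      ∀ x y → withoutMatching κ p x y ≡ withoutMatching κ p y x
withoutMatching-sym {κ} {p} κ-sym p-inv x y =
  cong₂ (λ k e → k ∧ not e) (κ-sym x y) (does-⇔ (mk⇔ (partner x y) (partner y x)) (p x ≟ y) (p y ≟ x))
  where
  partner : ∀ u v → p u ≡ v → p v ≡ u
  partner u v pu≡v = trans (cong p (sym pu≡v)) (p-inv u)

withoutMatching⇒ : ∀ {κ p x y} → withoutMatching κ p x y ≡ true → κ x y ≡ true
withoutMatching⇒ {κ} {p} {x} {y} wm with κ x y
... | true = refl

withoutMatching-degree : ∀ {n x} κ p → p x < n → κ x (p x) ≡ true →
                         degree n (withoutMatching κ p) x + 1 ≡ degree n κ x
withoutMatching-degree {n} {x} κ p px<n κxpx = begin
  degree n (withoutMatching κ p) x + 1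
    ≡⟨ cong (degree n (withoutMatching κ p) x +_) (sum-toℕ-δ px<n) ⟨
  degree n (withoutMatching κ p) x + ∑[ j < n ] 𝟙 (does (p x ≟ toℕ j))
    ≡⟨ ∑-distrib-+ {n} (λ j → 𝟙 (withoutMatching κ p x (toℕ j))) _ ⟨
  ∑[ j < n ] (𝟙 (withoutMatching κ p x (toℕ j)) + 𝟙 (does (p x ≟ toℕ j)))
    ≡⟨ sum-cong-≗ {n} (λ j → unmatch (κ x (toℕ j)) (p x ≟ toℕ j) matched) ⟩
  degree n κ x ∎
  where
  open ≡-Reasoning
  unmatch : ∀ k {P} (e : Dec P) → (P → k ≡ true) → 𝟙 (k ∧ not (does e)) + 𝟙 (does e) ≡ 𝟙 k
  unmatch true  (yes _) _    = refl
  unmatch true  (no _)  _    = refl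
  unmatch false (yes p) p⇒k = case p⇒k p of λ ()
  unmatch false (no _)  _    = refl
  matched : ∀ {y} → p x ≡ y → κ x y ≡ true
  matched refl = κxpx

swapParity : ℕ → ℕ
swapParity 0             = 1
swapParity 1             = 0
swapParity (suc (suc x)) = suc (suc (swapParity x))

swapParity-involutive : ∀ x → swapParity (swapParity x) ≡ x
swapParity-involutive 0             = refl
swapParity-involutive 1             = refl
swapParity-involutive (suc (suc x)) = cong (λ y → suc (suc y)) (swapParity-involutive x)

swapParity-< : ∀ {x} k → x < k + k → swapParity x < k + k
swapParity-< {0}             (suc k) _   = subst (1 <_) (sym (cong suc (+-suc k k))) (s≤s (s≤s z≤n))
swapParity-< {1}             (suc k) _   = s≤s z≤n
swapParity-< {suc (suc x)}   (suc k) x<k = subst (suc (suc (swapParity x)) <_) (sym (cong suc (+-suc k k)))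
  (s≤s (s≤s (swapParity-< k (s≤s⁻¹ (s≤s⁻¹ (subst (suc (suc (suc x)) ≤_) (cong suc (+-suc k k)) x<k))))))

swapParity-distance : ∀ x → ∣ x - swapParity x ∣ ≡ 1
swapParity-distance 0             = refl
swapParity-distance 1             = refl
swapParity-distance (suc (suc x)) = swapParity-distance x

-- A perfect matching of {0, …, 6 + 2m − 1} into pairs at distance 1 or 2 that keeps the triangle {1, 2, 3}.
pairing : ℕ → ℕ
pairing 0 = 1
pairing 1 = 0
pairing 2 = 4
pairing 3 = 5
pairing 4 = 2
pairing 5 = 3
pairing (suc (suc (suc (suc (suc (suc x)))))) = 6 + swapParity x

pairing-involutive : ∀ x → pairing (pairing x) ≡ x
pairing-involutive 0 = refl
pairing-involutive 1 = refl
pairing-involutive 2 = refl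
pairing-involutive 3 = refl
pairing-involutive 4 = refl
pairing-involutive 5 = refl
pairing-involutive (suc (suc (suc (suc (suc (suc x)))))) = cong (6 +_) (swapParity-involutive x)

pairing-< : ∀ {x} m → x < 6 + (m + m) → pairing x < 6 + (m + m)
pairing-< {0} m _ = s≤s (s≤s z≤n)
pairing-< {1} m _ = s≤s z≤n
pairing-< {2} m _ = s≤s (s≤s (s≤s (s≤s (s≤s z≤n))))
pairing-< {3} m _ = s≤s (s≤s (s≤s (s≤s (s≤s (s≤s z≤n)))))
pairing-< {4} m _ = s≤s (s≤s (s≤s z≤n))
pairing-< {5} m _ = s≤s (s≤s (s≤s (s≤s z≤n)))
pairing-< {suc (suc (suc (suc (suc (suc x)))))} m x<N = +-monoʳ-< 6 (swapParity-< m (+-cancelˡ-< 6 x (m + m) x<N))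

pairing-adjacent : ∀ N′ r′ x → circulant (6 + N′) (within (2 + r′)) x (pairing x) ≡ true
pairing-adjacent N′ r′ 0 = refl
pairing-adjacent N′ r′ 1 = refl
pairing-adjacent N′ r′ 2 = refl
pairing-adjacent N′ r′ 3 = refl
pairing-adjacent N′ r′ 4 = refl
pairing-adjacent N′ r′ 5 = refl
pairing-adjacent N′ r′ (suc (suc (suc (suc (suc (suc x)))))) rewrite swapParity-distance x = refl

-- The extremal wgraphs
complete : ℕ → ℕ → Bool
complete = complement (λ _ _ → false)

realizable-complete : ∀ {a} → 2 ≤ a → Realizable a 0 3 (a + 0 + 1)
realizable-complete {1} (s≤s ())
realizable-complete {suc (suc t)} _ = subst (Realizable (2 + t) 0 3) (sym a+0+1≡3+t)
  (withComplement-realizable complete (complement-sym (λ _ _ → refl)) (complement-irr _) complete-degree a+0+1≡3+t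
    (lightTriangle 0F 1F 2F (λ ()) (λ ()) (λ ()) refl refl refl))
  where
  open ≡-Reasoning
  a+0+1≡3+t : 2 + t + 0 + 1 ≡ 3 + t
  a+0+1≡3+t = trans (cong (_+ 1) (+-identityʳ (2 + t))) (+-comm (2 + t) 1)
  complete-degree : ∀ {x} → x < 3 + t → degree (3 + t) complete x ≡ 2 + t
  complete-degree {x} x<n = +-cancelʳ-≡ 1 _ _ (begin
    degree (3 + t) complete x + 1                                    ≡⟨ cong (λ e → e + degree (3 + t) complete x + 1) (sum-replicate-zero (3 + t)) ⟨
    degree (3 + t) (λ _ _ → false) x + degree (3 + t) complete x + 1 ≡⟨ complement-degree (λ _ _ → false) x<n refl ⟩
    3 + t                                                            ≡⟨ +-comm 1 (2 + t) ⟩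
    2 + t + 1                                                        ∎)

realizable-circulant : ∀ r′ b → let r = 2 + r′ in Realizable (r + r) b 3 (r + r + b + 1)
realizable-circulant r′ b = subst (Realizable (r + r) b 3) (sym (a+b+1≡N r′ b))
  (withComplement-realizable (circulant N (within r)) (circulant-sym N (within r)) (circulant-irr N (within r) refl)
    (λ x<N → trans (circulant-degree (within r) x<N) (within-count r (subst (r + r <_) (a+b+1≡N r′ b) 2r<a+b+1)))
    (a+b+1≡N r′ b)
    (lightTriangle 0F 1F 2F (λ ()) (λ ()) (λ ()) refl refl refl))
  where
  r = 2 + r′
  N = 5 + (r′ + r′ + b)
  a+b+1≡N : ∀ r′ b → (2 + r′) + (2 + r′) + b + 1 ≡ 5 + (r′ + r′ + b)
  a+b+1≡N = solve-∀
  2r<a+b+1 : r + r < r + r + b + 1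
  2r<a+b+1 = ≤-<-trans (m≤m+n (r + r) b) (m<m+n (r + r + b) (s≤s z≤n))

module PairedCirculant (k′ l : ℕ) where

  a r N : ℕ
  a = suc (suc k′ + suc k′)
  r = 2 + k′
  N = 6 + ((k′ + l) + (k′ + l))

  κ light : ℕ → ℕ → Bool
  κ     = circulant N (within r)
  light = withoutMatching κ pairing

  κ-sym : ∀ x y → κ x y ≡ κ y x
  κ-sym = circulant-sym N (within r)

  light-sym : ∀ x y → light x y ≡ light y x
  light-sym = withoutMatching-sym {p = pairing} κ-sym pairing-involutive

  light-irr : ∀ x → light x x ≡ false
  light-irr x = cong (_∧ _) (circulant-irr N (within r) refl x)

  κ-degree : ∀ {x} → x < N → degree N κ x ≡ a + 1
  κ-degree x<N = trans (circulant-degree (within r) x<N) (trans (within-count r r+r<N) (r+r≡a+1 k′))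
    where
    r+r≡a+1 : ∀ k′ → (2 + k′) + (2 + k′) ≡ suc (suc k′ + suc k′) + 1
    r+r≡a+1 = solve-∀
    N≡r+r+2+2l : ∀ k′ l → 6 + ((k′ + l) + (k′ + l)) ≡ (2 + k′) + (2 + k′) + suc (suc (l + l))
    N≡r+r+2+2l = solve-∀
    r+r<N : r + r < N
    r+r<N = subst (r + r <_) (sym (N≡r+r+2+2l k′ l)) (m<m+n (r + r) (s≤s z≤n))

  light-degree : ∀ {x} → x < N → degree N light x ≡ a
  light-degree {x} x<N = +-cancelʳ-≡ 1 _ _ (trans
    (withoutMatching-degree {x = x} κ pairing (pairing-< (k′ + l) x<N) (pairing-adjacent ((k′ + l) + (k′ + l)) k′ x))
    (κ-degree x<N))

realizable-odd-even : ∀ k′ l′ → let a = suc (suc k′ + suc k′); b = suc l′ + suc l′ in Realizable a b 3 (a + b + 1)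
realizable-odd-even k′ l′ = subst (Realizable a (suc l′ + suc l′) 3) (sym (a+b+1≡N k′ l′))
  (withComplement-realizable light light-sym light-irr light-degree (a+b+1≡N k′ l′)
    (lightTriangle 1F 2F 3F (λ ()) (λ ()) (λ ()) refl refl refl))
  where
  open PairedCirculant k′ l′
  a+b+1≡N : ∀ k′ l′ → suc (suc k′ + suc k′) + (suc l′ + suc l′) + 1 ≡ 6 + ((k′ + l′) + (k′ + l′))
  a+b+1≡N = solve-∀

realizable-odd-odd : ∀ k′ l → let a = suc (suc k′ + suc k′); b = suc (l + l) in Realizable a b 3 (a + b + 2)
realizable-odd-odd k′ l = subst (Realizable a (suc (l + l)) 3) (sym (a+b+2≡N k′ l))
  (WGraphOnℕ.realizable Γ light-degree (λ x<N → trans (cong (λ d → d + suc (l + l) + 1) (κ-degree x<N)) (a+1+b+1≡N k′ l))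
    (lightTriangle 1F 2F 3F (λ ()) (λ ()) (λ ()) refl refl refl))
  where
  open PairedCirculant k′ l
  Γ : WGraphOnℕ
  Γ = record
    { light = light ; notHeavy = κ ; light-sym = light-sym ; notHeavy-sym = κ-sym
    ; notHeavy-irr = circulant-irr N (within r) refl ; light⇒notHeavy = λ {x} {y} → withoutMatching⇒ {κ} {pairing} {x} {y} }
  a+b+2≡N : ∀ k′ l → suc (suc k′ + suc k′) + suc (l + l) + 2 ≡ 6 + ((k′ + l) + (k′ + l))
  a+b+2≡N = solve-∀
  a+1+b+1≡N : ∀ k′ l → suc (suc k′ + suc k′) + 1 + suc (l + l) + 1 ≡ 6 + ((k′ + l) + (k′ + l))
  a+1+b+1≡N = solve-∀

K₃⊕ : (ℕ → ℕ → Bool) → ℕ → ℕ → Bool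
K₃⊕ κ (suc (suc (suc x))) (suc (suc (suc y))) = κ x y
K₃⊕ κ (suc (suc (suc x))) _                   = false
K₃⊕ κ _                   (suc (suc (suc y))) = false
K₃⊕ κ x                   y                   = not (does (x ≟ y))

K₃⊕-sym : ∀ {κ} → (∀ x y → κ x y ≡ κ y x) → ∀ x y → K₃⊕ κ x y ≡ K₃⊕ κ y x
K₃⊕-sym κ-sym (suc (suc (suc x))) (suc (suc (suc y))) = κ-sym x y
K₃⊕-sym κ-sym (suc (suc (suc x))) 0 = refl
K₃⊕-sym κ-sym (suc (suc (suc x))) 1 = refl
K₃⊕-sym κ-sym (suc (suc (suc x))) 2 = refl
K₃⊕-sym κ-sym 0 (suc (suc (suc y))) = refl
K₃⊕-sym κ-sym 1 (suc (suc (suc y))) = refl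
K₃⊕-sym κ-sym 2 (suc (suc (suc y))) = refl
K₃⊕-sym κ-sym 0 0 = refl
K₃⊕-sym κ-sym 0 1 = refl
K₃⊕-sym κ-sym 0 2 = refl
K₃⊕-sym κ-sym 1 0 = refl
K₃⊕-sym κ-sym 1 1 = refl
K₃⊕-sym κ-sym 1 2 = refl
K₃⊕-sym κ-sym 2 0 = refl
K₃⊕-sym κ-sym 2 1 = refl
K₃⊕-sym κ-sym 2 2 = refl

K₃⊕-irr : ∀ {κ} → (∀ x → κ x x ≡ false) → ∀ x → K₃⊕ κ x x ≡ false
K₃⊕-irr κ-irr 0                   = refl
K₃⊕-irr κ-irr 1                   = refl
K₃⊕-irr κ-irr 2                   = refl
K₃⊕-irr κ-irr (suc (suc (suc x))) = κ-irr x

K₃⊕-degree : ∀ {m κ} → (∀ {x} → x < m → degree m κ x ≡ 2) → ∀ {x} → x < 3 + m → degree (3 + m) (K₃⊕ κ) x ≡ 2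
K₃⊕-degree {m} _ {0} _ = cong (2 +_) (sum-replicate-zero m)
K₃⊕-degree {m} _ {1} _ = cong (2 +_) (sum-replicate-zero m)
K₃⊕-degree {m} _ {2} _ = cong (2 +_) (sum-replicate-zero m)
K₃⊕-degree κ-degree {suc (suc (suc x))} x<3+m = κ-degree (+-cancelˡ-< 3 x _ x<3+m)

realizable-triangle⊕cycle : ∀ b′ → Realizable 2 (3 + b′) 3 (3 + (3 + b′))
realizable-triangle⊕cycle b′ = withComplement-realizable (K₃⊕ cycle) (K₃⊕-sym (circulant-sym (3 + b′) (within 1))) (K₃⊕-irr (circulant-irr (3 + b′) (within 1) refl))
  (K₃⊕-degree cycle-degree) (cong (5 +_) (+-comm b′ 1)) (lightTriangle 0F 1F 2F (λ ()) (λ ()) (λ ()) refl refl refl)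
  where
  cycle : ℕ → ℕ → Bool
  cycle = circulant (3 + b′) (within 1)
  cycle-degree : ∀ {x} → x < 3 + b′ → degree (3 + b′) cycle x ≡ 2
  cycle-degree x<n = trans (circulant-degree (within 1) x<n) (within-count {3 + b′} 1 (s≤s (s≤s (s≤s z≤n))))

realizable-2 : ∀ {b} → b ≢ 1 → b ≢ 2 → Realizable 2 b 3 (2 + b + 1)
realizable-2 {b} b≢1 b≢2 = subst (Realizable 2 b 3) (cong (2 +_) (+-comm 1 b)) (by-size b b≢1 b≢2)
  where
  by-size : ∀ b → b ≢ 1 → b ≢ 2 → Realizable 2 b 3 (3 + b)
  by-size 0                   _   _   = realizable-complete (s≤s (s≤s z≤n))
  by-size 1                   b≢1 _   = ⊥-elim (b≢1 refl)
  by-size 2                   _   b≢2 = ⊥-elim (b≢2 refl)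
  by-size (suc (suc (suc b′))) _   _   = realizable-triangle⊕cycle b′

realizable-two-triangles : ∀ {b} D → D 0 ≡ false → D 2 ≡ true → ∑[ j < 6 ] 𝟙 (D (toℕ j ⊓ (6 ∸ toℕ j))) + b + 1 ≡ 6 →
                           Realizable 2 b 3 6
realizable-two-triangles {b} D D0 D2 D-count = WGraphOnℕ.realizable Γ
  (circulant-degree distance2) (λ x<6 → trans (cong (λ d → d + b + 1) (circulant-degree D x<6)) D-count)
  (lightTriangle 0F 2F 4F (λ ()) (λ ()) (λ ()) refl refl refl)
  where
  distance2 : ℕ → Bool
  distance2 t = does (t ≟ 2)
  distance2⇒D : ∀ {t} → distance2 t ≡ true → D t ≡ true
  distance2⇒D {2} _ = D2
  distance2⇒D {0} ()
  distance2⇒D {1} ()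
  distance2⇒D {suc (suc (suc _))} ()
  Γ : WGraphOnℕ
  Γ = record
    { light = circulant 6 distance2 ; notHeavy = circulant 6 D
    ; light-sym = circulant-sym 6 distance2 ; notHeavy-sym = circulant-sym 6 D
    ; notHeavy-irr = circulant-irr 6 D D0 ; light⇒notHeavy = distance2⇒D }

-- The heavy graphs are the antipodal matching C₆(3) and the hexagon C₆(±1).
realizable-2-1 : Realizable 2 1 3 6
realizable-2-1 = realizable-two-triangles (within 2) refl refl refl

realizable-2-2 : Realizable 2 2 3 6
realizable-2-2 = realizable-two-triangles (λ t → does (2 ≤? t)) refl refl refl

realizable-ab-even : ∀ {a b} → 3 ≤ a → (a * b) % 2 ≡ 0 → Realizable a b 3 (a + b + 1)
realizable-ab-even {a} {b} 3≤a ab%2≡0 with parity a | parity b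
realizable-ab-even () _ | even 0 | _
realizable-ab-even (s≤s (s≤s ())) _ | even 1 | _
realizable-ab-even (s≤s ()) _ | odd 0 | _
... | even (suc (suc r′)) | _             = realizable-circulant r′ b
... | odd (suc _)         | even 0        = realizable-complete (s≤s (s≤s z≤n))
... | odd (suc k′)        | even (suc l′) = realizable-odd-even k′ l′
... | odd i               | odd j         = case trans (sym ab%2≡0) (odd*odd%2 i j) of λ ()

minOrder-ab-odd : ∀ {a b} → 3 ≤ a → (a * b) % 2 ≡ 1 → MinOrderIs a b 3 (a + b + 2)
minOrder-ab-odd {a} {b} 3≤a ab%2≡1 with parity a | parity b
minOrder-ab-odd (s≤s ()) _ | odd 0 | _
... | even k       | _      = case trans (sym ab%2≡1) (even*%2 k b) of λ ()
... | odd _        | even l = case trans (sym ab%2≡1) (*even%2 a l) of λ ()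
... | odd (suc k′) | odd l  = minOrderIs (realizable-odd-odd k′ l) (realizable-odd-odd⇒a+b+2≤k (suc k′) l)

theorem11 : (a b : ℕ) →
    (a < 2 → MinOrderInfinite a b 3)
    × (a ≡ 2 → (b ≡ 1 ⊎ b ≡ 2) → MinOrderIs a b 3 6)
    × (a ≡ 2 → b ≢ 1 → b ≢ 2 → MinOrderIs a b 3 (a + b + 1))
    × (3 ≤ a → (a * b) % 2 ≡ 0 → MinOrderIs a b 3 (a + b + 1))
    × (3 ≤ a → (a * b) % 2 ≡ 1 → MinOrderIs a b 3 (a + b + 2))
theorem11 a b =
    (λ a<2 _ R → <⇒≱ a<2 (realizable⇒2≤a R))
  , (λ { refl (inj₁ refl) → minOrderIs realizable-2-1 (realizable-2⇒6≤k ≤-refl)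
       ; refl (inj₂ refl) → minOrderIs realizable-2-2 (realizable-2⇒6≤k (s≤s z≤n)) })
  , (λ { refl b≢1 b≢2 → minOrderIs (realizable-2 b≢1 b≢2) realizable⇒a+b+1≤k })
  , (λ 3≤a ab%2≡0 → minOrderIs (realizable-ab-even 3≤a ab%2≡0) realizable⇒a+b+1≤k)
  , minOrder-ab-odd
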